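{- Let $f\colon X\to Y$ be a linear map between complete orthomodular lattices with adjoint $f^{*}$. Then $\ker f=\{x\in X\colon f(x)=0\}$ equals $\downarrow f^{*}(1)^{\perp}=\{x\in X\colon x\le f^{*}(1)^{\perp}\}$, and it is a complete orthomodular lattice.
   Context: An orthomodular lattice is a lattice with $0,1$ and an involutive, order-reversing orthocomplement $x\mapsto x^\perp$ with $x\wedge x^\perp=0$, satisfying $x\le y\Rightarrow y=x\vee(x^\perp\wedge y)$; complete means all joins exist. $x\perp y$ means $x\le y^{\perp}$. A function $f\colon X\to Y$ is linear if there is $f^{*}\colon Y\to X$ (its adjoint) with $f(x)\perp y$ iff $x\perp f^{*}(y)$ for all $x,y$. For $b\in X$, $\downarrow b$ is an orthomodular lattice with the order of $X$ and orthocomplement $u\mapsto b\wedge u^{\perp}$. -}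

module Defs where

open import Level using (0ℓ)
open import Data.Product using (Σ; _×_; _,_; proj₁; proj₂)
open import Function.Bundles using (_⇔_)
open import Relation.Binary.Structures using (IsPartialOrder)

record IsCompleteOML (A : Set) (_≈_ : A → A → Set) (_≤_ : A → A → Set)
                     (_ᶜ : A → A) : Set₁ where
  infixr 7 _∧_
  infixr 6 _∨_
  field
    isPartialOrder : IsPartialOrder _≈_ _≤_
    ᶜ-cong         : ∀ {x y} → x ≈ y → (x ᶜ) ≈ (y ᶜ)
    𝟘 𝟙            : A
    𝟘-min          : ∀ x → 𝟘 ≤ x
    𝟙-max          : ∀ x → x ≤ 𝟙
    _∧_ _∨_        : A → A → A
    ∧-lb₁          : ∀ x y → (x ∧ y) ≤ x
    ∧-lb₂          : ∀ x y → (x ∧ y) ≤ y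
    ∧-glb          : ∀ {x y z} → z ≤ x → z ≤ y → z ≤ (x ∧ y)
    ∨-ub₁          : ∀ x y → x ≤ (x ∨ y)
    ∨-ub₂          : ∀ x y → y ≤ (x ∨ y)
    ∨-lub          : ∀ {x y z} → x ≤ z → y ≤ z → (x ∨ y) ≤ z
    ᶜ-involutive   : ∀ x → ((x ᶜ) ᶜ) ≈ x
    ᶜ-antitone     : ∀ {x y} → x ≤ y → (y ᶜ) ≤ (x ᶜ)
    ᶜ-meet         : ∀ x → (x ∧ (x ᶜ)) ≈ 𝟘
    orthomodular   : ∀ {x y} → x ≤ y → y ≈ (x ∨ ((x ᶜ) ∧ y))
    ⋁              : (A → Set) → A
    ⋁-ub           : ∀ (S : A → Set) {x} → S x → x ≤ ⋁ S
    ⋁-lub          : ∀ (S : A → Set) {z} → (∀ {x} → S x → x ≤ z) → ⋁ S ≤ z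

record CompleteOML : Set₁ where
  field
    Carrier : Set
    _≈_     : Carrier → Carrier → Set
    _≤_     : Carrier → Carrier → Set
    _ᶜ      : Carrier → Carrier
    isCompleteOML : IsCompleteOML Carrier _≈_ _≤_ _ᶜ
  open IsCompleteOML isCompleteOML public

  _⊥_ : Carrier → Carrier → Set
  x ⊥ y = x ≤ (y ᶜ)

open CompleteOML

-- f : X → Y is linear with adjoint f* : f x ⊥ y iff x ⊥ f* y.
IsAdjoint : (X Y : CompleteOML) → (Carrier X → Carrier Y) → (Carrier Y → Carrier X) → Set
IsAdjoint X Y f f* = ∀ x y → (_⊥_ Y (f x) y) ⇔ (_⊥_ X x (f* y))

Ker : (X Y : CompleteOML) → (Carrier X → Carrier Y) → Set
Ker X Y f = Σ (Carrier X) λ x → _≈_ Y (f x) (𝟘 Y)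

-- The kernel condition f x = 0 is equivalent to f x ⊥ 1, hence by adjointness to
-- x ⊥ f*(1), i.e. x ≤ f*(1)ᶜ.  So the kernel is the principal down-set ↓b with
-- b = f*(1)ᶜ, and every principal down-set of a complete orthomodular lattice is
-- again one under the relative complement x ↦ b ∧ xᶜ: meets, joins and suprema
-- are inherited, and the orthomodular law of X gives both involutivity of the
-- relative complement and the relative orthomodular law.
module Submission where

open import Defs
open import Data.Product using (Σ; _×_; _,_; proj₁; proj₂)
open import Function.Bundles using (_⇔_; mk⇔; Equivalence)
open import Function.Properties.Equivalence using () renaming (trans to ⇔-trans)
open import Relation.Binary.Structures using (IsPartialOrder)
import Relation.Binary.Construct.On as On

module OMLProperties (X : CompleteOML) where
  open CompleteOML X
  open IsPartialOrder isPartialOrder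

  ∧-mono : ∀ {x y u v} → x ≤ u → y ≤ v → (x ∧ y) ≤ (u ∧ v)
  ∧-mono x≤u y≤v = ∧-glb (trans (∧-lb₁ _ _) x≤u) (trans (∧-lb₂ _ _) y≤v)

  ∨-mono : ∀ {x y u v} → x ≤ u → y ≤ v → (x ∨ y) ≤ (u ∨ v)
  ∨-mono x≤u y≤v = ∨-lub (trans x≤u (∨-ub₁ _ _)) (trans y≤v (∨-ub₂ _ _))

  x∧xᶜ≤𝟘 : ∀ x → (x ∧ (x ᶜ)) ≤ 𝟘
  x∧xᶜ≤𝟘 x = reflexive (ᶜ-meet x)

  𝟙ᶜ≤𝟘 : (𝟙 ᶜ) ≤ 𝟘
  𝟙ᶜ≤𝟘 = trans (∧-glb (𝟙-max _) refl) (x∧xᶜ≤𝟘 𝟙)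

  ≈𝟘⇔⊥𝟙 : ∀ x → (x ≈ 𝟘) ⇔ (x ⊥ 𝟙)
  ≈𝟘⇔⊥𝟙 x = mk⇔ (λ x≈𝟘 → trans (reflexive x≈𝟘) (𝟘-min _))
                (λ x≤𝟙ᶜ → antisym (trans x≤𝟙ᶜ 𝟙ᶜ≤𝟘) (𝟘-min x))

ker⇔≤adjoint-𝟙ᶜ : (X Y : CompleteOML) (f : CompleteOML.Carrier X → CompleteOML.Carrier Y)
                  (f* : CompleteOML.Carrier Y → CompleteOML.Carrier X) → IsAdjoint X Y f f* →
                  ∀ x → CompleteOML._≈_ Y (f x) (CompleteOML.𝟘 Y)
                        ⇔ CompleteOML._≤_ X x (CompleteOML._ᶜ X (f* (CompleteOML.𝟙 Y)))
ker⇔≤adjoint-𝟙ᶜ X Y f f* adj x =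
  ⇔-trans (OMLProperties.≈𝟘⇔⊥𝟙 Y (f x)) (adj x (CompleteOML.𝟙 Y))

-- ↓b is presented as the subtype of any predicate P equivalent to _≤ b, so that
-- the kernel, whose defining predicate is f x ≈ 𝟘, is an instance.
module DownSet (X : CompleteOML) (b : CompleteOML.Carrier X)
               (P : CompleteOML.Carrier X → Set)
               (P⇔≤b : ∀ x → P x ⇔ CompleteOML._≤_ X x b) where
  open CompleteOML X
  open IsPartialOrder isPartialOrder
  open OMLProperties X

  ↓b : Set
  ↓b = Σ Carrier P

  bound : ∀ (u : ↓b) → proj₁ u ≤ b
  bound (x , p) = Equivalence.to (P⇔≤b x) p

  below : ∀ {x} → x ≤ b → P x
  below {x} = Equivalence.from (P⇔≤b x)

  relᶜ : ↓b → ↓b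
  relᶜ (x , _) = (b ∧ (x ᶜ)) , below (∧-lb₁ _ _)

  relᶜ-involutive : ∀ {x} → x ≤ b → (b ∧ ((b ∧ (x ᶜ)) ᶜ)) ≈ x
  relᶜ-involutive {x} x≤b = antisym L≤x x≤L
    where
      L = b ∧ ((b ∧ (x ᶜ)) ᶜ)

      x≤L : x ≤ L
      x≤L = ∧-glb x≤b (trans (reflexive (Eq.sym (ᶜ-involutive x))) (ᶜ-antitone (∧-lb₂ _ _)))

      xᶜ∧L≤𝟘 : ((x ᶜ) ∧ L) ≤ 𝟘
      xᶜ∧L≤𝟘 = trans (∧-glb (∧-glb (trans (∧-lb₂ _ _) (∧-lb₁ _ _)) (∧-lb₁ _ _))
                            (trans (∧-lb₂ _ _) (∧-lb₂ _ _)))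
                     (x∧xᶜ≤𝟘 (b ∧ (x ᶜ)))

      L≤x : L ≤ x
      L≤x = trans (reflexive (orthomodular x≤L)) (∨-lub refl (trans xᶜ∧L≤𝟘 (𝟘-min x)))

  relative-orthomodular : ∀ {x y} → x ≤ y → y ≤ b → y ≈ (x ∨ ((b ∧ (x ᶜ)) ∧ y))
  relative-orthomodular x≤y y≤b = antisym
    (trans (reflexive (orthomodular x≤y))
           (∨-mono refl (∧-glb (∧-glb (trans (∧-lb₂ _ _) y≤b) (∧-lb₁ _ _)) (∧-lb₂ _ _))))
    (∨-lub x≤y (∧-lb₂ _ _))

  ↓b-isCompleteOML : IsCompleteOML ↓b (λ u v → proj₁ u ≈ proj₁ v) (λ u v → proj₁ u ≤ proj₁ v) relᶜ
  ↓b-isCompleteOML = record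
    { isPartialOrder = On.isPartialOrder proj₁ isPartialOrder
    ; ᶜ-cong         = λ x≈y → antisym (∧-mono refl (ᶜ-antitone (reflexive (Eq.sym x≈y))))
                                       (∧-mono refl (ᶜ-antitone (reflexive x≈y)))
    ; 𝟘              = 𝟘 , below (𝟘-min b)
    ; 𝟙              = b , below refl
    ; 𝟘-min          = λ _ → 𝟘-min _
    ; 𝟙-max          = bound
    ; _∧_            = λ u v → (proj₁ u ∧ proj₁ v) , below (trans (∧-lb₁ _ _) (bound u))
    ; _∨_            = λ u v → (proj₁ u ∨ proj₁ v) , below (∨-lub (bound u) (bound v))
    ; ∧-lb₁          = λ _ _ → ∧-lb₁ _ _
    ; ∧-lb₂          = λ _ _ → ∧-lb₂ _ _
    ; ∧-glb          = ∧-glb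
    ; ∨-ub₁          = λ _ _ → ∨-ub₁ _ _
    ; ∨-ub₂          = λ _ _ → ∨-ub₂ _ _
    ; ∨-lub          = ∨-lub
    ; ᶜ-involutive   = λ u → relᶜ-involutive (bound u)
    ; ᶜ-antitone     = λ x≤y → ∧-mono refl (ᶜ-antitone x≤y)
    ; ᶜ-meet         = λ _ → antisym (trans (∧-mono refl (∧-lb₂ _ _)) (x∧xᶜ≤𝟘 _)) (𝟘-min _)
    ; orthomodular   = λ {_} {v} x≤y → relative-orthomodular x≤y (bound v)
    ; ⋁              = λ S → ⋁ (underlying S) , below (⋁-lub (underlying S) λ (p , _) → bound (_ , p))
    ; ⋁-ub           = λ S {u} s → ⋁-ub (underlying S) (proj₂ u , s)
    ; ⋁-lub          = λ S bounded → ⋁-lub (underlying S) λ (_ , s) → bounded s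
    }
    where
      underlying : (↓b → Set) → Carrier → Set
      underlying S x = Σ (P x) λ p → S (x , p)

lemma10 : (X Y : CompleteOML) (f : CompleteOML.Carrier X → CompleteOML.Carrier Y)
            (f* : CompleteOML.Carrier Y → CompleteOML.Carrier X) → IsAdjoint X Y f f* →
            ((x : CompleteOML.Carrier X) →
              (CompleteOML._≈_ Y (f x) (CompleteOML.𝟘 Y))
                ⇔ (CompleteOML._≤_ X x (CompleteOML._ᶜ X (f* (CompleteOML.𝟙 Y)))))
            × (Σ (Ker X Y f → Ker X Y f) λ c →
                ((u : Ker X Y f) → CompleteOML._≈_ X (proj₁ (c u))
                   (CompleteOML._∧_ X (CompleteOML._ᶜ X (f* (CompleteOML.𝟙 Y)))
                                     (CompleteOML._ᶜ X (proj₁ u))))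
                × IsCompleteOML (Ker X Y f)
                    (λ u v → CompleteOML._≈_ X (proj₁ u) (proj₁ v))
                    (λ u v → CompleteOML._≤_ X (proj₁ u) (proj₁ v))
                    c)
lemma10 X Y f f* adj =
  ker⇔≤b , relᶜ , (λ _ → IsPartialOrder.Eq.refl (CompleteOML.isPartialOrder X)) , ↓b-isCompleteOML
  where
    ker⇔≤b : ∀ x → CompleteOML._≈_ Y (f x) (CompleteOML.𝟘 Y)
                   ⇔ CompleteOML._≤_ X x (CompleteOML._ᶜ X (f* (CompleteOML.𝟙 Y)))
    ker⇔≤b = ker⇔≤adjoint-𝟙ᶜ X Y f f* adj
    open DownSet X (CompleteOML._ᶜ X (f* (CompleteOML.𝟙 Y)))
                 (λ x → CompleteOML._≈_ Y (f x) (CompleteOML.𝟘 Y)) ker⇔≤b
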